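{- Let $G$ be a cluster graph that is not $\eta$-balanced, and let $k,\eta$ be non-negative integers. If there exists $F\subseteq\binom{V(G)}{2}\setminus E(G)$ with $|F|\le k$ such that $G+F$ is an $\eta$-balanced cluster graph, then $\mathrm{scomp}(G)\le k$ and $\mathrm{lcomp}(G)\le 2k+\eta$.
   Context: A cluster graph is a graph in which every connected component is a clique; a graph is $\eta$-balanced if any two of its connected components differ in number of vertices by at most $\eta$. $G+F=(V(G),E(G)\cup F)$. $\mathrm{lcomp}(G)$ and $\mathrm{scomp}(G)$ denote the number of vertices of a largest and of a smallest connected component of $G$, respectively. -}

module Defs where

open import Data.Nat using (ℕ; _+_; _*_; _≤_; _<ᵇ_)
open import Data.Bool using (Bool; true; false; _∧_; _∨_; if_then_else_)
open import Data.Fin using (Fin; toℕ)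
open import Data.List using (List; length; map; allFin; cartesianProduct)
open import Data.Nat.ListAction using (sum)
open import Data.List.Membership.Propositional using (_∈_)
open import Data.List.Relation.Unary.Unique.Propositional using (Unique)
open import Data.Product using (_×_; _,_; Σ; ∃; ∃-syntax)
open import Relation.Binary.PropositionalEquality using (_≡_; _≢_)
open import Relation.Binary.Construct.Closure.ReflexiveTransitive using (Star)
open import Function.Bundles using (_⇔_)

record Graph (n : ℕ) : Set where
  field
    adj    : Fin n → Fin n → Bool
    sym    : ∀ u v → adj u v ≡ adj v u
    irrefl : ∀ u → adj u u ≡ false
open Graph public

Adj : ∀ {n} → Graph n → Fin n → Fin n → Set
Adj G u v = adj G u v ≡ true

Connected : ∀ {n} → Graph n → Fin n → Fin n → Set
Connected G = Star (Adj G)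

IsCluster : ∀ {n} → Graph n → Set
IsCluster G = ∀ u v → Connected G u v → u ≢ v → Adj G u v

-- CompSize G v s : the connected component containing v has exactly s vertices
-- (witnessed by a duplicate-free list enumerating exactly that component).
CompSize : ∀ {n} → Graph n → Fin n → ℕ → Set
CompSize G v s = Σ (List _) λ xs → Unique xs × length xs ≡ s × (∀ w → (w ∈ xs ⇔ Connected G v w))

Balanced : ∀ {n} → ℕ → Graph n → Set
Balanced η G = ∀ u v s t → CompSize G u s → CompSize G v t → s ≤ t + η

-- Number of edges (unordered pairs {i,j}, counted with toℕ i < toℕ j).
edgeCount : ∀ {n} → Graph n → ℕ
edgeCount {n} G = sum (map (λ { (i , j) → if adj G i j ∧ (toℕ i <ᵇ toℕ j) then 1 else 0 })
                           (cartesianProduct (allFin n) (allFin n)))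

_⊕_ : ∀ {n} → Graph n → Graph n → Graph n
adj    (G ⊕ F) u v = adj G u v ∨ adj F u v
sym    (G ⊕ F) u v rewrite Graph.sym G u v | Graph.sym F u v = Relation.Binary.PropositionalEquality.refl
  where import Relation.Binary.PropositionalEquality
irrefl (G ⊕ F) u rewrite Graph.irrefl G u | Graph.irrefl F u = Relation.Binary.PropositionalEquality.refl
  where import Relation.Binary.PropositionalEquality

NonEdgesOf : ∀ {n} → Graph n → Graph n → Set
NonEdgesOf F G = ∀ u v → Adj F u v → adj G u v ≡ false

-- scomp(G) ≤ m : the smallest component has at most m vertices
ScompLe : ∀ {n} → Graph n → ℕ → Set
ScompLe G m = ∃[ v ] ∃[ s ] (CompSize G v s × s ≤ m)

-- lcomp(G) ≤ m : the largest component has at most m vertices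
LcompLe : ∀ {n} → Graph n → ℕ → Set
LcompLe G m = ∀ v s → CompSize G v s → s ≤ m

{-# OPTIONS --safe #-}
module Submission where

-- An edge uv of F exists, since otherwise G + F = G would be balanced. In the
-- cluster graph G + F, an F-edge yz makes z adjacent to the whole G-component
-- of y, and not through G-edges (z is not in that component), so that
-- component lies in the F-neighbourhood of z, which has at most |F| ≤ k
-- vertices. This bounds the component of u, and every component meeting an
-- F-edge. A component meeting no F-edge is also a component of G + F, so it is
-- at most η larger than the component of uv in G + F, which lies in the union
-- of the F-neighbourhoods of u and v and hence has at most 2k vertices.

open import Defs hiding (sym)
open import Data.Bool using (Bool; true; false; T; _∧_; if_then_else_)
import Data.Bool as Bool
open import Data.Bool.Properties using (T-≡; T-∧; ∨-zeroʳ)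
open import Data.Fin using (Fin; toℕ)
import Data.Fin.Properties as Fin
open import Data.List using (List; []; _∷_; _++_; length; map; filter; filterᵇ; allFin; cartesianProduct)
open import Data.List.Properties using (length-++; length-++-sucʳ; length-map)
open import Data.List.Membership.Propositional using (_∈_; find; lose)
open import Data.List.Membership.Propositional.Properties
  using (∈-∃++; ∈-++⁺ˡ; ∈-++⁺ʳ; ∈-filter⁺; ∈-filter⁻; ∈-allFin; ∈-cartesianProduct⁺; ∈-map⁻)
open import Data.List.Relation.Binary.Subset.Propositional using (_⊆_)
import Data.List.Relation.Unary.All as All
open import Data.List.Relation.Unary.AllPairs using (_∷_)
open import Data.List.Relation.Unary.Any using (here; there; any?)
open import Data.List.Relation.Unary.Unique.Propositional using (Unique)
import Data.List.Relation.Unary.Unique.Propositional.Properties as Unique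
open import Data.Nat using (ℕ; suc; _+_; _*_; _≤_; _<_; _<ᵇ_; z≤n; s≤s)
open import Data.Nat.ListAction using (sum)
open import Data.Nat.Properties
  using (≤-trans; ≤-reflexive; +-mono-≤; +-monoˡ-≤; m≤m+n; <⇒<ᵇ; ≮⇒≥; ≤∧≢⇒<; module ≤-Reasoning)
open import Data.Product using (_×_; _,_; proj₁; proj₂; ∃-syntax)
open import Data.Sum using (_⊎_; inj₁; inj₂)
open import Function using (_∘_; id)
open import Function.Bundles using (mk⇔; Equivalence)
open import Relation.Binary.Construct.Closure.ReflexiveTransitive using (ε; _◅_; _◅◅_; gmap; reverse)
open import Relation.Binary.PropositionalEquality using (_≡_; _≢_; refl; sym; trans; cong; subst)
open import Relation.Nullary using (¬_; yes; no; contradiction)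

module _ {A : Set} where

  ∈-++-skip : ∀ {x z : A} ys {zs} → z ≢ x → z ∈ ys ++ x ∷ zs → z ∈ ys ++ zs
  ∈-++-skip []       z≢x (here z≡x)  = contradiction z≡x z≢x
  ∈-++-skip []       z≢x (there z∈zs) = z∈zs
  ∈-++-skip (y ∷ ys) z≢x (here z≡y)  = here z≡y
  ∈-++-skip (y ∷ ys) z≢x (there z∈)  = there (∈-++-skip ys z≢x z∈)

  Unique-⊆⇒length≤ : {xs ys : List A} → Unique xs → xs ⊆ ys → length xs ≤ length ys
  Unique-⊆⇒length≤ {[]}     _            _     = z≤n
  Unique-⊆⇒length≤ {x ∷ xs} (x∉xs ∷ uxs) xs⊆ys with ys₁ , ys₂ , refl ← ∈-∃++ (xs⊆ys (here refl)) =
    ≤-trans (s≤s (Unique-⊆⇒length≤ uxs xs⊆ys₁++ys₂)) (≤-reflexive (sym (length-++-sucʳ ys₁ x ys₂)))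
    where
    xs⊆ys₁++ys₂ : xs ⊆ ys₁ ++ ys₂
    xs⊆ys₁++ys₂ z∈xs = ∈-++-skip ys₁ (λ z≡x → All.lookup x∉xs z∈xs (sym z≡x)) (xs⊆ys (there z∈xs))

  sum-indicator≡length-filterᵇ : (p : A → Bool) (xs : List A) →
    sum (map (λ x → if p x then 1 else 0) xs) ≡ length (filterᵇ p xs)
  sum-indicator≡length-filterᵇ p []       = refl
  sum-indicator≡length-filterᵇ p (x ∷ xs) with p x
  ... | true  = cong suc (sum-indicator≡length-filterᵇ p xs)
  ... | false = sum-indicator≡length-filterᵇ p xs

module _ {n : ℕ} where

  Adj⇒≢ : (H : Graph n) {v w : Fin n} → Adj H v w → v ≢ w
  Adj⇒≢ H {v} vw refl with () ← trans (sym (Graph.irrefl H v)) vw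

  Adj-sym : (H : Graph n) {u v : Fin n} → Adj H u v → Adj H v u
  Adj-sym H {u} {v} uv = trans (Graph.sym H v u) uv

  Connected-sym : (H : Graph n) {u v : Fin n} → Connected H u v → Connected H v u
  Connected-sym H = reverse (Adj-sym H)

  neighbours : Graph n → Fin n → List (Fin n)
  neighbours H v = filter (λ w → adj H v w Bool.≟ true) (allFin n)

  degree : Graph n → Fin n → ℕ
  degree H v = length (neighbours H v)

  ∈-neighbours⁺ : (H : Graph n) {v w : Fin n} → Adj H v w → w ∈ neighbours H v
  ∈-neighbours⁺ H vw = ∈-filter⁺ _ (∈-allFin _) vw

  ∈-neighbours⁻ : (H : Graph n) {v w : Fin n} → w ∈ neighbours H v → Adj H v w
  ∈-neighbours⁻ H w∈ = proj₂ (∈-filter⁻ _ {xs = allFin n} w∈)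

  Unique-neighbours : (H : Graph n) (v : Fin n) → Unique (neighbours H v)
  Unique-neighbours H v = Unique.filter⁺ _ (Unique.allFin⁺ n)

  isEdge : Graph n → Fin n × Fin n → Bool
  isEdge H (i , j) = adj H i j ∧ (toℕ i <ᵇ toℕ j)

  edges : Graph n → List (Fin n × Fin n)
  edges H = filterᵇ (isEdge H) (cartesianProduct (allFin n) (allFin n))

  edgeCount≡length-edges : (H : Graph n) → edgeCount H ≡ length (edges H)
  edgeCount≡length-edges H = sum-indicator≡length-filterᵇ (isEdge H) (cartesianProduct (allFin n) (allFin n))

  orderedPair : Fin n → Fin n → Fin n × Fin n
  orderedPair v w = if toℕ v <ᵇ toℕ w then (v , w) else (w , v)

  orderedPair-injective : ∀ v {a b} → orderedPair v a ≡ orderedPair v b → a ≡ b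
  orderedPair-injective v {a} {b} eq with toℕ v <ᵇ toℕ a | toℕ v <ᵇ toℕ b
  ... | true  | true  = cong proj₂ eq
  ... | false | false = cong proj₁ eq
  ... | true  | false = trans (cong proj₂ eq) (cong proj₁ eq)
  ... | false | true  = trans (cong proj₁ eq) (cong proj₂ eq)

  isEdge-orderedPair : (H : Graph n) {v w : Fin n} → Adj H v w → T (isEdge H (orderedPair v w))
  isEdge-orderedPair H {v} {w} vw with toℕ v <ᵇ toℕ w in v<ᵇw
  ... | true  = Equivalence.from T-∧ (Equivalence.from T-≡ vw , subst T (sym v<ᵇw) _)
  ... | false = Equivalence.from T-∧ (Equivalence.from T-≡ (Adj-sym H vw) , <⇒<ᵇ w<v)
    where
    w<v : toℕ w < toℕ v
    w<v = ≤∧≢⇒< (≮⇒≥ λ v<w → subst T v<ᵇw (<⇒<ᵇ v<w))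
                (λ w≡v → Adj⇒≢ H vw (sym (Fin.toℕ-injective w≡v)))

  degree≤edgeCount : (H : Graph n) (v : Fin n) → degree H v ≤ edgeCount H
  degree≤edgeCount H v = begin
    degree H v                                    ≡⟨ length-map (orderedPair v) (neighbours H v) ⟨
    length (map (orderedPair v) (neighbours H v)) ≤⟨ Unique-⊆⇒length≤ unique ⊆edges ⟩
    length (edges H)                              ≡⟨ edgeCount≡length-edges H ⟨
    edgeCount H                                   ∎
    where
    open ≤-Reasoning
    unique = Unique.map⁺ (orderedPair-injective v) (Unique-neighbours H v)
    ⊆edges : map (orderedPair v) (neighbours H v) ⊆ edges H
    ⊆edges e∈ with w , w∈ , refl ← ∈-map⁻ (orderedPair v) e∈ =
      ∈-filter⁺ (Bool.T? ∘ isEdge H) (∈-cartesianProduct⁺ (∈-allFin _) (∈-allFin _))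
                (isEdge-orderedPair H (∈-neighbours⁻ H w∈))

  cluster-CompSize : (H : Graph n) → IsCluster H → (u : Fin n) → CompSize H u (suc (degree H u))
  cluster-CompSize H clH u = u ∷ neighbours H u , unique , refl , λ w → mk⇔ to from
    where
    unique : Unique (u ∷ neighbours H u)
    unique = All.tabulate (λ w∈ → Adj⇒≢ H (∈-neighbours⁻ H w∈)) ∷ Unique-neighbours H u
    to : ∀ {w} → w ∈ u ∷ neighbours H u → Connected H u w
    to (here refl) = ε
    to (there w∈)  = ∈-neighbours⁻ H w∈ ◅ ε
    from : ∀ {w} → Connected H u w → w ∈ u ∷ neighbours H u
    from {w} uw with u Fin.≟ w
    ... | yes refl = here refl
    ... | no u≢w   = there (∈-neighbours⁺ H (clH u w uw u≢w))

  CompSize≤length : (H : Graph n) {v : Fin n} {s : ℕ} {ys : List (Fin n)} → CompSize H v s →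
    (∀ {w} → Connected H v w → w ∈ ys) → s ≤ length ys
  CompSize≤length H (xs , unique , refl , xs⇔comp) comp⊆ys =
    Unique-⊆⇒length≤ unique λ {w} w∈xs → comp⊆ys (Equivalence.to (xs⇔comp w) w∈xs)

  module ⊕-Properties (G F : Graph n) where

    Adj-⊕ˡ : {u v : Fin n} → Adj G u v → Adj (G ⊕ F) u v
    Adj-⊕ˡ {u} {v} uv = cong (Bool._∨ adj F u v) uv

    Adj-⊕ʳ : {u v : Fin n} → Adj F u v → Adj (G ⊕ F) u v
    Adj-⊕ʳ {u} {v} uv = trans (cong (adj G u v Bool.∨_) uv) (∨-zeroʳ (adj G u v))

    Adj-⊕⁻ : {u v : Fin n} → Adj (G ⊕ F) u v → Adj G u v ⊎ Adj F u v
    Adj-⊕⁻ {u} {v} uv with adj G u v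
    ... | true  = inj₁ refl
    ... | false = inj₂ uv

    Connected-⊕ˡ : {u v : Fin n} → Connected G u v → Connected (G ⊕ F) u v
    Connected-⊕ˡ = gmap id Adj-⊕ˡ

module Completion {n : ℕ} (G F : Graph n) (clG : IsCluster G) (F∩G≡∅ : NonEdgesOf F G)
                  (clG⊕F : IsCluster (G ⊕ F)) where

  open ⊕-Properties G F

  F-edge⇒¬Connected : {y z : Fin n} → Adj F y z → ¬ Connected G y z
  F-edge⇒¬Connected {y} {z} yz c with () ← trans (sym (F∩G≡∅ y z yz)) (clG y z c (Adj⇒≢ F yz))

  F-neighbour-of-component : {y z w : Fin n} → Adj F y z → Connected G y w → Adj F z w
  F-neighbour-of-component {y} {z} {w} yz yw
    with Adj-⊕⁻ (clG⊕F z w (Adj-⊕ʳ (Adj-sym F yz) ◅ Connected-⊕ˡ yw) z≢w)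
    where
    z≢w : z ≢ w
    z≢w refl = F-edge⇒¬Connected yz yw
  ... | inj₁ G-zw = contradiction (yw ◅◅ Adj-sym G G-zw ◅ ε) (F-edge⇒¬Connected yz)
  ... | inj₂ F-zw = F-zw

  F-Isolated : Fin n → Set
  F-Isolated x = ∀ {y z} → Connected G x y → ¬ Adj F y z

  F-Isolated⇒Connected-⊕⇒Connected : {x a w : Fin n} → F-Isolated x →
    Connected G x a → Connected (G ⊕ F) a w → Connected G x w
  F-Isolated⇒Connected-⊕⇒Connected iso xa ε = xa
  F-Isolated⇒Connected-⊕⇒Connected iso xa (ab ◅ bw) with Adj-⊕⁻ ab
  ... | inj₁ G-ab = F-Isolated⇒Connected-⊕⇒Connected iso (xa ◅◅ G-ab ◅ ε) bw
  ... | inj₂ F-ab = contradiction F-ab (iso xa)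

  F-Isolated-CompSize-⊕ : {x : Fin n} {s : ℕ} → F-Isolated x → CompSize G x s → CompSize (G ⊕ F) x s
  F-Isolated-CompSize-⊕ iso (xs , unique , len , xs⇔comp) = xs , unique , len , λ w →
    mk⇔ (Connected-⊕ˡ ∘ Equivalence.to (xs⇔comp w))
        (Equivalence.from (xs⇔comp w) ∘ F-Isolated⇒Connected-⊕⇒Connected iso ε)

  F-edge-or-F-Isolated : {x : Fin n} {s : ℕ} → CompSize G x s →
    (∃[ y ] ∃[ z ] Connected G x y × Adj F y z) ⊎ F-Isolated x
  F-edge-or-F-Isolated (xs , _ , _ , xs⇔comp)
    with any? (λ y → Fin.any? λ z → adj F y z Bool.≟ true) xs
  ... | yes F-edge-in-xs with y , y∈xs , z , yz ← find F-edge-in-xs =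
    inj₁ (y , z , Equivalence.to (xs⇔comp y) y∈xs , yz)
  ... | no ¬F-edge-in-xs = inj₂ λ {y} xy yz → ¬F-edge-in-xs (lose (Equivalence.from (xs⇔comp y) xy) (_ , yz))

  F-edge-exists : {η : ℕ} → ¬ Balanced η G → Balanced η (G ⊕ F) → ∃[ u ] ∃[ v ] Adj F u v
  F-edge-exists ¬bal bal with Fin.any? (λ u → Fin.any? λ v → adj F u v Bool.≟ true)
  ... | yes F-edge = F-edge
  ... | no ¬F-edge = contradiction (λ u v s t us vt → bal u v s t (⊕-CompSize us) (⊕-CompSize vt)) ¬bal
    where
    ⊕-CompSize : {x : Fin n} {s : ℕ} → CompSize G x s → CompSize (G ⊕ F) x s
    ⊕-CompSize = F-Isolated-CompSize-⊕ λ _ yz → ¬F-edge (_ , _ , yz)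

  CompSize≤degree : {x y z : Fin n} {s : ℕ} → Connected G x y → Adj F y z → CompSize G x s → s ≤ degree F z
  CompSize≤degree xy yz C =
    CompSize≤length G C λ xw → ∈-neighbours⁺ F (F-neighbour-of-component yz (Connected-sym G xy ◅◅ xw))

  CompSize-⊕≤degree+degree : {u v : Fin n} {s : ℕ} → Adj F u v → CompSize (G ⊕ F) v s →
    s ≤ degree F u + degree F v
  CompSize-⊕≤degree+degree {u} {v} uv C =
    ≤-trans (CompSize≤length (G ⊕ F) C comp⊆) (≤-reflexive (length-++ (neighbours F u)))
    where
    comp⊆ : ∀ {w} → Connected (G ⊕ F) v w → w ∈ neighbours F u ++ neighbours F v
    comp⊆ {w} vw with v Fin.≟ w
    ... | yes refl = ∈-++⁺ˡ (∈-neighbours⁺ F uv)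
    ... | no v≢w with Adj-⊕⁻ (clG⊕F v w vw v≢w)
    ...   | inj₁ G-vw = ∈-++⁺ˡ (∈-neighbours⁺ F (F-neighbour-of-component (Adj-sym F uv) (G-vw ◅ ε)))
    ...   | inj₂ F-vw = ∈-++⁺ʳ (neighbours F u) (∈-neighbours⁺ F F-vw)

  ScompLe-maxDegree : {η Δ : ℕ} → ¬ Balanced η G → Balanced η (G ⊕ F) → (∀ v → degree F v ≤ Δ) →
    ScompLe G Δ
  ScompLe-maxDegree ¬bal bal degree≤Δ with u , v , uv ← F-edge-exists ¬bal bal =
    u , _ , cluster-CompSize G clG u , ≤-trans (CompSize≤degree ε uv (cluster-CompSize G clG u)) (degree≤Δ v)

  LcompLe-maxDegree : {η Δ : ℕ} → ¬ Balanced η G → Balanced η (G ⊕ F) → (∀ v → degree F v ≤ Δ) →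
    LcompLe G (2 * Δ + η)
  LcompLe-maxDegree {η} {Δ} ¬bal bal degree≤Δ x s C with F-edge-or-F-Isolated C
  ... | inj₁ (y , z , xy , yz) =
    ≤-trans (CompSize≤degree xy yz C) (≤-trans (degree≤Δ z) (≤-trans (m≤m+n Δ (Δ + 0)) (m≤m+n (2 * Δ) η)))
  ... | inj₂ iso with u , v , uv ← F-edge-exists ¬bal bal =
    ≤-trans (bal x v s _ (F-Isolated-CompSize-⊕ iso C) D) (+-monoˡ-≤ η D≤2Δ)
    where
    D : CompSize (G ⊕ F) v (suc (degree (G ⊕ F) v))
    D = cluster-CompSize (G ⊕ F) clG⊕F v
    D≤2Δ : suc (degree (G ⊕ F) v) ≤ 2 * Δ
    D≤2Δ = ≤-trans (CompSize-⊕≤degree+degree uv D) (+-mono-≤ (degree≤Δ u) (≤-trans (degree≤Δ v) (m≤m+n Δ 0)))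

mainTheorem19 : ∀ {n} (G : Graph n) (k η : ℕ) → IsCluster G → ¬ Balanced η G →
    (∃[ F ] (NonEdgesOf F G × edgeCount F ≤ k × IsCluster (G ⊕ F) × Balanced η (G ⊕ F))) →
    ScompLe G k × LcompLe G (2 * k + η)
mainTheorem19 G k η clG ¬bal (F , F∩G≡∅ , |F|≤k , clG⊕F , bal) =
  ScompLe-maxDegree ¬bal bal degree≤k , LcompLe-maxDegree ¬bal bal degree≤k
  where
  open Completion G F clG F∩G≡∅ clG⊕F
  degree≤k : ∀ v → degree F v ≤ k
  degree≤k v = ≤-trans (degree≤edgeCount F v) |F|≤k
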